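{- Let $G$ and $H$ be connected graphs with $\mathrm{vol}(G)\ge 6$, and let $f:V(G)\to V(H)$ be any non-constant function. Then $$\sum_{u,v} d_H(f(u),f(v))^2 d_u d_v\ \ge\ \mathrm{vol}(G)-1,$$ where the sum is over unordered pairs $\{u,v\}$ of vertices of $G$.
   Context: Graphs are finite and simple; $d_u$ is the degree of $u$ in $G$, $\mathrm{vol}(G)=\sum_{u\in V(G)}d_u$, and $d_H$ is the shortest-path distance in $H$. -}

module Defs where

open import Data.Nat using (ℕ; zero; suc; _+_; _*_; _^_; _<_)
open import Data.Nat.Properties using (_<?_)
open import Data.Bool using (Bool; true; false; _∧_; _∨_; if_then_else_)
open import Data.Fin using (Fin; toℕ; _≟_)
open import Data.List using (List; []; _∷_; map; filter; concatMap)
open import Data.Nat.ListAction using (sum)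
open import Data.Bool.ListAction using (any)
open import Data.List using (allFin)
open import Data.Product using (∃; _×_)
open import Relation.Binary.PropositionalEquality using (_≡_)
open import Relation.Nullary.Decidable using (⌊_⌋)

record Graph (n : ℕ) : Set where
  field
    adj     : Fin n → Fin n → Bool
    symm    : ∀ u v → adj u v ≡ adj v u
    irrefl  : ∀ u → adj u u ≡ false
open Graph public

deg : ∀ {n} → Graph n → Fin n → ℕ
deg G u = sum (map (λ v → if adj G u v then 1 else 0) (allFin _))

vol : ∀ {n} → Graph n → ℕ
vol {n} G = sum (map (deg G) (allFin n))

data Walk {n : ℕ} (G : Graph n) : Fin n → Fin n → ℕ → Set where
  here : ∀ {u} → Walk G u u 0
  step : ∀ {u w v k} → adj G u w ≡ true → Walk G w v k → Walk G u v (suc k)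

Connected : ∀ {n} → Graph n → Set
Connected G = ∀ u v → ∃ λ k → Walk G u v k

within : ∀ {n} → Graph n → ℕ → Fin n → Fin n → Bool
within G zero    u v = ⌊ u ≟ v ⌋
within G (suc k) u v = within G k u v ∨ any (λ w → adj G u w ∧ within G k w v) (allFin _)

searchFrom : ∀ {n} → Graph n → Fin n → Fin n → ℕ → ℕ → ℕ
searchFrom G u v i zero       = i
searchFrom G u v i (suc fuel) =
  if within G i u v then i else searchFrom G u v (suc i) fuel

-- shortest-path distance d_G(u,v): minimum length of a walk from u to v
-- (a shortest walk has length < n; value n is returned only if unreachable,
-- which never happens for connected graphs)
dist : ∀ {n} → Graph n → Fin n → Fin n → ℕ
dist {n} G u v = searchFrom G u v 0 n

-- sum over unordered pairs {u,v} (u ≠ v), enumerated as toℕ u < toℕ v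
sumPairs : ∀ n → (Fin n → Fin n → ℕ) → ℕ
sumPairs n F =
  sum (concatMap (λ u → map (λ v → F u v)
                    (filter (λ v → toℕ u <? toℕ v) (allFin n)))
                 (allFin n))

-- Let S be the fibre of f through a vertex u₀ and Sᶜ its complement; both have positive
-- volume, because in a connected graph on at least two vertices every degree is positive.
-- Each pair split by S has d_H ≥ 1, so the sum dominates the crossing sum
-- Σ_{u ∈ S, v ∉ S} d_u d_v = vol(S) · vol(Sᶜ) ≥ vol(S) + vol(Sᶜ) − 1 = vol(G) − 1.
-- Over unordered pairs the crossing kernel is symmetric with zero diagonal, so twice its
-- sum is the full double sum, which factorises.
module Submission where

open import Defs
open import Data.Nat using (ℕ; _≤_; _∸_; _*_; _^_)
open import Data.Fin using (Fin)
open import Data.Product using (∃₂)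
open import Relation.Binary.PropositionalEquality using (_≢_)

open import Data.Nat.Properties
open import Algebra.Properties.Semiring.Sum +-*-semiring
  using (sum-syntax; ∑-distrib-+; ∑-comm; sum-cong-≗; sum-remove; *-distribˡ-sum; *-distribʳ-sum)
  renaming (sum to ∑)
open import Data.Bool using (Bool; true; false; not; if_then_else_)
open import Data.Fin as Fin using (zero; suc; toℕ)
open import Data.Fin.Properties using (toℕ-injective)
open import Data.List using (List; []; _∷_; map; filter; concat; tabulate; allFin)
open import Data.List.Properties using (map-∘)
open import Data.Nat using (zero; suc; _+_; _<_; z≤n; >-nonZero)
open import Data.Nat.ListAction using (sum)
open import Data.Nat.ListAction.Properties using (sum-++)
open import Data.Product using (_,_)
open import Function using (_∘_; case_of_)
open import Relation.Binary.PropositionalEquality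
open import Relation.Nullary using (¬_; does; yes; no; contradiction)
open import Relation.Binary.Definitions using (tri<; tri≈; tri>)
open import Relation.Nullary.Decidable using (dec-true; dec-false)
open import Relation.Unary using (Decidable)

variable
  m n : ℕ

+-double-injective : ∀ {a b} → a + a ≡ b + b → a ≡ b
+-double-injective {zero}  {zero}  _  = refl
+-double-injective {suc a} {suc b} eq = cong suc (+-double-injective (suc-injective
  (trans (sym (+-suc a a)) (trans (suc-injective eq) (+-suc b b)))))

+∸1≤* : ∀ {a b} → 1 ≤ a → 1 ≤ b → a + b ∸ 1 ≤ a * b
+∸1≤* {suc a} {suc b} _ _ = begin
  a + suc b       ≡⟨ +-comm a (suc b) ⟩
  suc b + a       ≤⟨ +-monoʳ-≤ (suc b) (m≤m*n a (suc b)) ⟩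
  suc b + a * suc b ∎
  where open ≤-Reasoning

∑-mono-≤ : ∀ {f g : Fin n → ℕ} → (∀ i → f i ≤ g i) → ∑ f ≤ ∑ g
∑-mono-≤ {zero}  f≤g = z≤n
∑-mono-≤ {suc n} f≤g = +-mono-≤ (f≤g zero) (∑-mono-≤ (f≤g ∘ suc))

≤-∑ : (t : Fin n → ℕ) (i : Fin n) → t i ≤ ∑ t
≤-∑ {suc n} t i = ≤-trans (m≤m+n (t i) _) (≤-reflexive (sym (sum-remove t)))

∑∑-separable : (x : Fin m → ℕ) (y : Fin n → ℕ) →
  ∑[ i < m ] ∑[ j < n ] (x i * y j) ≡ ∑ x * ∑ y
∑∑-separable x y = begin
  ∑[ i < _ ] ∑[ j < _ ] (x i * y j) ≡⟨ sum-cong-≗ (λ i → sym (*-distribˡ-sum (x i) y)) ⟩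
  ∑[ i < _ ] (x i * ∑ y)            ≡⟨ sym (*-distribʳ-sum (∑ y) x) ⟩
  ∑ x * ∑ y                         ∎
  where open ≡-Reasoning

sum-map-tabulate : ∀ {A : Set} (g : A → ℕ) (h : Fin n → A) → sum (map g (tabulate h)) ≡ ∑ (g ∘ h)
sum-map-tabulate {zero}  g h = refl
sum-map-tabulate {suc n} g h = cong (g (h zero) +_) (sum-map-tabulate g (h ∘ suc))

sum-map-allFin : (g : Fin n → ℕ) → sum (map g (allFin n)) ≡ ∑ g
sum-map-allFin g = sum-map-tabulate g (λ i → i)

sum-concat : (xss : List (List ℕ)) → sum (concat xss) ≡ sum (map sum xss)
sum-concat []         = refl
sum-concat (xs ∷ xss) = trans (sum-++ xs (concat xss)) (cong (sum xs +_) (sum-concat xss))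

sum-map-filter : ∀ {A : Set} {P : A → Set} (P? : Decidable P) (g : A → ℕ) (xs : List A) →
  sum (map g (filter P? xs)) ≡ sum (map (λ x → if does (P? x) then g x else 0) xs)
sum-map-filter P? g []       = refl
sum-map-filter P? g (x ∷ xs) with does (P? x)
... | true  = cong (g x +_) (sum-map-filter P? g xs)
... | false = sum-map-filter P? g xs

upper : (Fin n → Fin n → ℕ) → Fin n → Fin n → ℕ
upper F u v = if does (toℕ u <? toℕ v) then F u v else 0

sumPairs≡∑∑upper : (F : Fin n → Fin n → ℕ) →
  sumPairs n F ≡ ∑[ u < n ] ∑[ v < n ] upper F u v
sumPairs≡∑∑upper {n} F = begin
  sumPairs n F                                  ≡⟨ sum-concat (map row (allFin n)) ⟩
  sum (map sum (map row (allFin n)))            ≡⟨ cong sum (sym (map-∘ (allFin n))) ⟩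
  sum (map (sum ∘ row) (allFin n))              ≡⟨ sum-map-allFin (sum ∘ row) ⟩
  ∑[ u < n ] sum (row u)                        ≡⟨ sum-cong-≗ row≡∑upper ⟩
  ∑[ u < n ] ∑[ v < n ] upper F u v             ∎
  where
  open ≡-Reasoning
  row : Fin n → List ℕ
  row u = map (F u) (filter (λ v → toℕ u <? toℕ v) (allFin n))
  row≡∑upper : ∀ u → sum (row u) ≡ ∑ (upper F u)
  row≡∑upper u = trans (sum-map-filter (λ v → toℕ u <? toℕ v) (F u) (allFin n))
                       (sum-map-allFin (upper F u))

sumPairs-mono-≤ : ∀ {F G : Fin n → Fin n → ℕ} → (∀ u v → F u v ≤ G u v) →
  sumPairs n F ≤ sumPairs n G
sumPairs-mono-≤ {F = F} {G} F≤G = begin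
  sumPairs _ F                    ≡⟨ sumPairs≡∑∑upper F ⟩
  ∑[ u < _ ] ∑[ v < _ ] upper F u v ≤⟨ ∑-mono-≤ (λ u → ∑-mono-≤ (upper-mono u)) ⟩
  ∑[ u < _ ] ∑[ v < _ ] upper G u v ≡⟨ sumPairs≡∑∑upper G ⟨
  sumPairs _ G                    ∎
  where
  open ≤-Reasoning
  upper-mono : ∀ u v → upper F u v ≤ upper G u v
  upper-mono u v with does (toℕ u <? toℕ v)
  ... | true  = F≤G u v
  ... | false = z≤n

upper-< : ∀ (F : Fin n → Fin n → ℕ) {u v} → toℕ u < toℕ v → upper F u v ≡ F u v
upper-< F {u} {v} u<v = cong (λ b → if b then F u v else 0) (dec-true (toℕ u <? toℕ v) u<v)

upper-≮ : ∀ (F : Fin n → Fin n → ℕ) {u v} → ¬ toℕ u < toℕ v → upper F u v ≡ 0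
upper-≮ F {u} {v} u≮v = cong (λ b → if b then F u v else 0) (dec-false (toℕ u <? toℕ v) u≮v)

upper-+-upper-flip : ∀ {K : Fin n → Fin n → ℕ} → (∀ u v → K u v ≡ K v u) → (∀ u → K u u ≡ 0) →
  ∀ u v → upper K u v + upper K v u ≡ K u v
upper-+-upper-flip {K = K} sym-K diag-K u v with <-cmp (toℕ u) (toℕ v)
... | tri< u<v _ v≮u = trans (cong₂ _+_ (upper-< K u<v) (upper-≮ K v≮u)) (+-identityʳ (K u v))
... | tri> u≮v _ v<u = trans (cong₂ _+_ (upper-≮ K u≮v) (upper-< K v<u)) (sym (sym-K u v))
... | tri≈ u≮v u≡v _ with toℕ-injective u≡v
... | refl = trans (cong₂ _+_ (upper-≮ K u≮v) (upper-≮ K u≮v)) (sym (diag-K u))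

sumPairs-symmetric : ∀ {K : Fin n → Fin n → ℕ} → (∀ u v → K u v ≡ K v u) → (∀ u → K u u ≡ 0) →
  sumPairs n K + sumPairs n K ≡ ∑[ u < n ] ∑[ v < n ] K u v
sumPairs-symmetric {n} {K} sym-K diag-K = begin
  sumPairs n K + sumPairs n K
    ≡⟨ cong₂ _+_ (sumPairs≡∑∑upper K) (sumPairs≡∑∑upper K) ⟩
  ∑[ u < n ] ∑[ v < n ] U u v + ∑[ u < n ] ∑[ v < n ] U u v
    ≡⟨ cong (∑[ u < n ] ∑[ v < n ] U u v +_) (∑-comm U) ⟩
  ∑[ u < n ] ∑[ v < n ] U u v + ∑[ u < n ] ∑[ v < n ] U v u
    ≡⟨ ∑-distrib-+ (λ u → ∑[ v < n ] U u v) (λ u → ∑[ v < n ] U v u) ⟨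
  ∑[ u < n ] (∑[ v < n ] U u v + ∑[ v < n ] U v u)
    ≡⟨ sum-cong-≗ (λ u → ∑-distrib-+ (U u) (λ v → U v u)) ⟨
  ∑[ u < n ] ∑[ v < n ] (U u v + U v u)
    ≡⟨ sum-cong-≗ (λ u → sum-cong-≗ (upper-+-upper-flip sym-K diag-K u)) ⟩
  ∑[ u < n ] ∑[ v < n ] K u v
    ∎
  where
  open ≡-Reasoning
  U : Fin n → Fin n → ℕ
  U = upper K

restrict : (Fin n → Bool) → (Fin n → ℕ) → Fin n → ℕ
restrict s w u = if s u then w u else 0

restrict-+-restrict-not : ∀ (s : Fin n → Bool) w u → restrict s w u + restrict (not ∘ s) w u ≡ w u
restrict-+-restrict-not s w u with s u
... | true  = +-identityʳ (w u)
... | false = refl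

∑-restrict-split : ∀ (s : Fin n → Bool) w → ∑ w ≡ ∑ (restrict s w) + ∑ (restrict (not ∘ s) w)
∑-restrict-split s w = trans (sum-cong-≗ (sym ∘ restrict-+-restrict-not s w))
                             (∑-distrib-+ (restrict s w) (restrict (not ∘ s) w))

≤-∑-restrict : ∀ (s : Fin n → Bool) w {u} → s u ≡ true → w u ≤ ∑ (restrict s w)
≤-∑-restrict s w {u} su = subst (_≤ ∑ (restrict s w)) (cong (λ b → if b then w u else 0) su)
                                (≤-∑ (restrict s w) u)

crossing : (Fin n → Bool) → (Fin n → ℕ) → Fin n → Fin n → ℕ
crossing s w u v = restrict s w u * restrict (not ∘ s) w v + restrict (not ∘ s) w u * restrict s w v

crossing-sym : ∀ (s : Fin n → Bool) w u v → crossing s w u v ≡ crossing s w v u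
crossing-sym s w u v =
  trans (+-comm (x u * y v) (y u * x v)) (cong₂ _+_ (*-comm (y u) (x v)) (*-comm (x u) (y v)))
  where
  x y : Fin _ → ℕ
  x = restrict s w
  y = restrict (not ∘ s) w

crossing-diag : ∀ (s : Fin n → Bool) w u → crossing s w u u ≡ 0
crossing-diag s w u with s u
... | true  = trans (+-identityʳ (w u * 0)) (*-zeroʳ (w u))
... | false = *-zeroʳ (w u)

crossing-≤ : ∀ (s : Fin n → Bool) w {F : Fin n → Fin n → ℕ} →
  (∀ u v → s u ≢ s v → w u * w v ≤ F u v) → ∀ u v → crossing s w u v ≤ F u v
crossing-≤ s w {F} separated u v with s u in su | s v in sv
... | true  | true  = ≤-trans (≤-reflexive (trans (+-identityʳ (w u * 0)) (*-zeroʳ (w u)))) z≤n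
... | false | false = ≤-trans (≤-reflexive (*-zeroʳ (w u))) z≤n
... | true  | false = subst (_≤ F u v) (sym (+-identityʳ (w u * w v)))
                            (separated u v λ su≡sv → case trans (sym su) (trans su≡sv sv) of λ ())
... | false | true  = separated u v λ su≡sv → case trans (sym su) (trans su≡sv sv) of λ ()

sumPairs-crossing : ∀ (s : Fin n → Bool) w →
  sumPairs n (crossing s w) ≡ ∑ (restrict s w) * ∑ (restrict (not ∘ s) w)
sumPairs-crossing {n} s w = +-double-injective (begin
  sumPairs n (crossing s w) + sumPairs n (crossing s w)
    ≡⟨ sumPairs-symmetric (crossing-sym s w) (crossing-diag s w) ⟩
  ∑[ u < n ] ∑[ v < n ] (x u * y v + y u * x v)
    ≡⟨ sum-cong-≗ (λ u → ∑-distrib-+ (λ v → x u * y v) (λ v → y u * x v)) ⟩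
  ∑[ u < n ] (∑[ v < n ] (x u * y v) + ∑[ v < n ] (y u * x v))
    ≡⟨ ∑-distrib-+ (λ u → ∑[ v < n ] (x u * y v)) (λ u → ∑[ v < n ] (y u * x v)) ⟩
  ∑[ u < n ] ∑[ v < n ] (x u * y v) + ∑[ u < n ] ∑[ v < n ] (y u * x v)
    ≡⟨ cong₂ _+_ (∑∑-separable x y) (∑∑-separable y x) ⟩
  ∑ x * ∑ y + ∑ y * ∑ x
    ≡⟨ cong (∑ x * ∑ y +_) (*-comm (∑ y) (∑ x)) ⟩
  ∑ x * ∑ y + ∑ x * ∑ y
    ∎)
  where
  open ≡-Reasoning
  x y : Fin n → ℕ
  x = restrict s w
  y = restrict (not ∘ s) w

∑∸1≤sumPairs : ∀ (s : Fin n → Bool) w {F : Fin n → Fin n → ℕ} {u₀ v₀} →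
  s u₀ ≡ true → s v₀ ≡ false → 1 ≤ w u₀ → 1 ≤ w v₀ →
  (∀ u v → s u ≢ s v → w u * w v ≤ F u v) → ∑ w ∸ 1 ≤ sumPairs n F
∑∸1≤sumPairs {n} s w {F} su₀ sv₀ 1≤wu₀ 1≤wv₀ separated = begin
  ∑ w ∸ 1                     ≡⟨ cong (_∸ 1) (∑-restrict-split s w) ⟩
  ∑ x + ∑ y ∸ 1               ≤⟨ +∸1≤* (≤-trans 1≤wu₀ (≤-∑-restrict s w su₀))
                                       (≤-trans 1≤wv₀ (≤-∑-restrict (not ∘ s) w (cong not sv₀))) ⟩
  ∑ x * ∑ y                   ≡⟨ sumPairs-crossing s w ⟨
  sumPairs n (crossing s w)   ≤⟨ sumPairs-mono-≤ (crossing-≤ s w separated) ⟩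
  sumPairs n F                ∎
  where
  open ≤-Reasoning
  x y : Fin n → ℕ
  x = restrict s w
  y = restrict (not ∘ s) w

vol≡∑deg : (G : Graph n) → vol G ≡ ∑ (deg G)
vol≡∑deg G = sum-map-allFin (deg G)

adj⇒deg≥1 : (G : Graph n) {u v : Fin n} → adj G u v ≡ true → 1 ≤ deg G u
adj⇒deg≥1 G {u} {v} uv = begin
  1                                          ≡⟨ cong (λ b → if b then 1 else 0) uv ⟨
  (if adj G u v then 1 else 0)               ≤⟨ ≤-∑ (λ v → if adj G u v then 1 else 0) v ⟩
  ∑[ v < _ ] (if adj G u v then 1 else 0)    ≡⟨ sum-map-allFin (λ v → if adj G u v then 1 else 0) ⟨
  deg G u                                    ∎
  where open ≤-Reasoning

connected⇒deg≥1 : (G : Graph n) → Connected G → ∀ {u v} → u ≢ v → 1 ≤ deg G u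
connected⇒deg≥1 G connected {u} {v} u≢v with connected u v
... | zero  , here       = contradiction refl u≢v
... | suc _ , step uw _  = adj⇒deg≥1 G uw

searchFrom-≥ : (H : Graph n) (x y : Fin n) (i fuel : ℕ) → i ≤ searchFrom H x y i fuel
searchFrom-≥ H x y i zero       = ≤-refl
searchFrom-≥ H x y i (suc fuel) with within H i x y
... | true  = ≤-refl
... | false = ≤-trans (n≤1+n i) (searchFrom-≥ H x y (suc i) fuel)

dist≥1 : (H : Graph n) {x y : Fin n} → x ≢ y → 1 ≤ dist H x y
dist≥1 {suc n} H {x} {y} x≢y with x Fin.≟ y
... | yes x≡y = contradiction x≡y x≢y
... | no _    = searchFrom-≥ H x y 1 n

m*n≤dist²*m*n : (H : Graph n) {x y : Fin n} → x ≢ y → ∀ a b → a * b ≤ dist H x y ^ 2 * a * b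
m*n≤dist²*m*n H {x} {y} x≢y a b = begin
  a * b                     ≤⟨ m≤n*m (a * b) (dist H x y ^ 2) {{>-nonZero 1≤dist²}} ⟩
  dist H x y ^ 2 * (a * b)  ≡⟨ *-assoc (dist H x y ^ 2) a b ⟨
  dist H x y ^ 2 * a * b    ∎
  where
  open ≤-Reasoning
  1≤dist² : 1 ≤ dist H x y ^ 2
  1≤dist² = ^-monoˡ-≤ 2 (dist≥1 H x≢y)

theorem3p2 : ∀ {m n} (G : Graph m) (H : Graph n) →
    Connected G → Connected H → 6 ≤ vol G →
    (f : Fin m → Fin n) → ∃₂ (λ u v → f u ≢ f v) →
    vol G ∸ 1 ≤ sumPairs m (λ u v → dist H (f u) (f v) ^ 2 * deg G u * deg G v)
theorem3p2 G H connected _ _ f (u₀ , v₀ , fu₀≢fv₀) =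
  subst (λ V → V ∸ 1 ≤ sumPairs _ weighted) (sym (vol≡∑deg G))
    (∑∸1≤sumPairs inFibre (deg G)
      (dec-true (f u₀ Fin.≟ f u₀) refl) (dec-false (f v₀ Fin.≟ f u₀) (fu₀≢fv₀ ∘ sym))
      (connected⇒deg≥1 G connected u₀≢v₀) (connected⇒deg≥1 G connected (u₀≢v₀ ∘ sym))
      separated)
  where
  inFibre : Fin _ → Bool
  inFibre u = does (f u Fin.≟ f u₀)
  u₀≢v₀ : u₀ ≢ v₀
  u₀≢v₀ = fu₀≢fv₀ ∘ cong f
  weighted : Fin _ → Fin _ → ℕ
  weighted u v = dist H (f u) (f v) ^ 2 * deg G u * deg G v
  separated : ∀ u v → inFibre u ≢ inFibre v → deg G u * deg G v ≤ weighted u v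
  separated u v split = m*n≤dist²*m*n H (split ∘ cong (λ z → does (z Fin.≟ f u₀))) (deg G u) (deg G v)
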